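{- Let $\ast_c$ be a choice revision on $K$ satisfying, for all finite $A,B\subseteq\mathcal{L}$: (relative success) $K\ast_c A=K$ or $A\cap(K\ast_c A)\neq\emptyset$; and (regularity) if $A\cap(K\ast_c B)\neq\emptyset$ then $A\cap(K\ast_c A)\neq\emptyset$. Then $\ast_c$ satisfies reciprocity (for all finite $A,B$: if $(K\ast_c A)\cap B\neq\emptyset$ and $(K\ast_c B)\cap A\neq\emptyset$ then $K\ast_c A=K\ast_c B$) if and only if it satisfies cautiousness (for all finite $A,B$: if $A\subseteq B$ and $(K\ast_c B)\cap A\neq\emptyset$ then $K\ast_c A=K\ast_c B$).
   Context: $\mathcal{L}$ is a propositional language; $\mathrm{Cn}$ is a supraclassical, compact consequence operation on $\mathcal{L}$ with the deduction property. A belief set is $X\subseteq\mathcal{L}$ with $X=\mathrm{Cn}(X)$; $K$ is a fixed consistent belief set. A choice revision on $K$ is a function $\ast_c$ assigning to each finite $A\subseteq\mathcal{L}$ a set $K\ast_c A\subseteq\mathcal{L}$. -}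

module Defs where

open import Data.Nat using (ℕ)
open import Data.Bool using (Bool; true; false; not; _∧_; _∨_)
open import Data.List using (List; []; _∷_)
open import Data.List.Membership.Propositional using (_∈_)
open import Data.Product using (Σ; ∃; _×_; _,_)
open import Data.Sum using (_⊎_)
open import Relation.Binary.PropositionalEquality using (_≡_)
open import Relation.Nullary using (¬_)

data Formula : Set where
  atom : ℕ → Formula
  ⊥'   : Formula
  ¬'_  : Formula → Formula
  _∧'_ : Formula → Formula → Formula
  _∨'_ : Formula → Formula → Formula
  _⇒'_ : Formula → Formula → Formula

eval : (ℕ → Bool) → Formula → Bool
eval v (atom n) = v n
eval v ⊥' = false
eval v (¬' φ) = not (eval v φ)
eval v (φ ∧' ψ) = eval v φ ∧ eval v ψ
eval v (φ ∨' ψ) = eval v φ ∨ eval v ψ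
eval v (φ ⇒' ψ) = not (eval v φ) ∨ eval v ψ

ClassicallyEntails : (Formula → Set) → Formula → Set
ClassicallyEntails X φ = ∀ (v : ℕ → Bool) → (∀ ψ → X ψ → eval v ψ ≡ true) → eval v φ ≡ true

FSet : Set₁
FSet = Formula → Set

_⊆_ : FSet → FSet → Set
X ⊆ Y = ∀ φ → X φ → Y φ

_≐_ : FSet → FSet → Set
X ≐ Y = (X ⊆ Y) × (Y ⊆ X)

-- A finite set of formulas, given by a list.
⟦_⟧ : List Formula → FSet
⟦ A ⟧ φ = φ ∈ A

_∪_ : FSet → FSet → FSet
(X ∪ Y) φ = X φ ⊎ Y φ

Meets : FSet → FSet → Set
Meets X Y = ∃ λ φ → X φ × Y φ

record ConsequenceOperation : Set₁ where
  field
    Cn          : FSet → FSet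
    inclusion   : ∀ X → X ⊆ Cn X
    monotony    : ∀ X Y → X ⊆ Y → Cn X ⊆ Cn Y
    iteration   : ∀ X → Cn (Cn X) ⊆ Cn X
    supraclassical : ∀ X φ → ClassicallyEntails X φ → Cn X φ
    compact     : ∀ X φ → Cn X φ → ∃ λ (A : List Formula) → (⟦ A ⟧ ⊆ X) × Cn ⟦ A ⟧ φ
    deduction   : ∀ X φ ψ → Cn (X ∪ (λ χ → χ ≡ φ)) ψ → Cn X (φ ⇒' ψ)
    deduction⁻  : ∀ X φ ψ → Cn X (φ ⇒' ψ) → Cn (X ∪ (λ χ → χ ≡ φ)) ψ

module _ (C : ConsequenceOperation) where
  open ConsequenceOperation C

  BeliefSet : FSet → Set
  BeliefSet X = Cn X ⊆ X

  Consistent : FSet → Set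
  Consistent X = ¬ Cn X ⊥'

ChoiceRevision : Set₁
ChoiceRevision = List Formula → FSet

module _ (K : FSet) (rev : ChoiceRevision) where

  RelativeSuccess : Set
  RelativeSuccess = ∀ A → (rev A ≐ K) ⊎ Meets ⟦ A ⟧ (rev A)

  Regularity : Set
  Regularity = ∀ A B → Meets ⟦ A ⟧ (rev B) → Meets ⟦ A ⟧ (rev A)

  Reciprocity : Set
  Reciprocity = ∀ A B → Meets (rev A) ⟦ B ⟧ → Meets (rev B) ⟦ A ⟧ → rev A ≐ rev B

  Cautiousness : Set
  Cautiousness = ∀ A B → ⟦ A ⟧ ⊆ ⟦ B ⟧ → Meets (rev B) ⟦ A ⟧ → rev A ≐ rev B

-- Reciprocity ⇒ cautiousness: regularity turns the witness of rev B ∩ A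
-- into one of rev A ∩ A ⊆ rev A ∩ B.  Cautiousness ⇒ reciprocity: both
-- rev A and rev B are compared with rev (A ∪ B).  Regularity makes
-- rev (A ∪ B) meet A ∪ B, say in A; cautiousness then gives
-- rev A ≐ rev (A ∪ B), so rev (A ∪ B) meets B as well and a second use of
-- cautiousness gives rev B ≐ rev (A ∪ B).
module Submission where

open import Defs
open import Function using (_∘′_)
open import Function.Bundles using (_⇔_; mk⇔)
open import Data.List using (List; _++_)
open import Data.List.Membership.Propositional.Properties using (∈-++⁺ˡ; ∈-++⁺ʳ; ∈-++⁻)
open import Data.Product using (_,_)
open import Data.Sum using (inj₁; inj₂)

≐-sym : ∀ {X Y} → X ≐ Y → Y ≐ X
≐-sym (X⊆Y , Y⊆X) = Y⊆X , X⊆Y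

≐-trans : ∀ {X Y Z} → X ≐ Y → Y ≐ Z → X ≐ Z
≐-trans (X⊆Y , Y⊆X) (Y⊆Z , Z⊆Y) =
  (λ φ → Y⊆Z φ ∘′ X⊆Y φ) , (λ φ → Y⊆X φ ∘′ Z⊆Y φ)

Meets-comm : ∀ {X Y} → Meets X Y → Meets Y X
Meets-comm (φ , Xφ , Yφ) = φ , Yφ , Xφ

Meets-monoʳ : ∀ {X Y Z} → Y ⊆ Z → Meets X Y → Meets X Z
Meets-monoʳ Y⊆Z (φ , Xφ , Yφ) = φ , Xφ , Y⊆Z φ Yφ

Meets-transportˡ : ∀ {X Y Z} → X ≐ Y → Meets X Z → Meets Y Z
Meets-transportˡ (X⊆Y , _) (φ , Xφ , Zφ) = φ , X⊆Y φ Xφ , Zφ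

⟦⟧-++ˡ : (A B : List Formula) → ⟦ A ⟧ ⊆ ⟦ A ++ B ⟧
⟦⟧-++ˡ A B _ = ∈-++⁺ˡ

⟦⟧-++ʳ : (A B : List Formula) → ⟦ B ⟧ ⊆ ⟦ A ++ B ⟧
⟦⟧-++ʳ A B _ = ∈-++⁺ʳ A

module _ {K : FSet} {rev : ChoiceRevision} (regular : Regularity K rev) where

  reciprocity⇒cautiousness : Reciprocity K rev → Cautiousness K rev
  reciprocity⇒cautiousness reciprocal A B A⊆B revB∩A =
    reciprocal A B (Meets-monoʳ A⊆B (Meets-comm (regular A B (Meets-comm revB∩A))))
                   revB∩A

  module _ (cautious : Cautiousness K rev) where

    cautious-++ˡ : ∀ A B → Meets (rev (A ++ B)) ⟦ A ⟧ → rev A ≐ rev (A ++ B)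
    cautious-++ˡ A B = cautious A (A ++ B) (⟦⟧-++ˡ A B)

    cautious-++ʳ : ∀ A B → Meets (rev (A ++ B)) ⟦ B ⟧ → rev B ≐ rev (A ++ B)
    cautious-++ʳ A B = cautious B (A ++ B) (⟦⟧-++ʳ A B)

    cautiousness⇒reciprocity : Reciprocity K rev
    cautiousness⇒reciprocity A B revA∩B revB∩A
      with regular (A ++ B) A (Meets-comm (Meets-monoʳ (⟦⟧-++ʳ A B) revA∩B))
    ... | χ , χ∈A++B , revA++Bχ with ∈-++⁻ A χ∈A++B
    ... | inj₁ χ∈A = ≐-trans revA≐ (≐-sym revB≐)
      where
      revA≐ : rev A ≐ rev (A ++ B)
      revA≐ = cautious-++ˡ A B (χ , revA++Bχ , χ∈A)
      revB≐ : rev B ≐ rev (A ++ B)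
      revB≐ = cautious-++ʳ A B (Meets-transportˡ revA≐ revA∩B)
    ... | inj₂ χ∈B = ≐-trans revA≐ (≐-sym revB≐)
      where
      revB≐ : rev B ≐ rev (A ++ B)
      revB≐ = cautious-++ʳ A B (χ , revA++Bχ , χ∈B)
      revA≐ : rev A ≐ rev (A ++ B)
      revA≐ = cautious-++ˡ A B (Meets-transportˡ revB≐ revB∩A)

mainTheorem3 : (C : ConsequenceOperation) (K : FSet)
    → BeliefSet C K → Consistent C K
    → (rev : ChoiceRevision)
    → RelativeSuccess K rev → Regularity K rev
    → Reciprocity K rev ⇔ Cautiousness K rev
mainTheorem3 C K _ _ rev _ regular =
  mk⇔ (reciprocity⇒cautiousness {K} regular) (cautiousness⇒reciprocity {K} regular)
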